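{- Let $n\geq 1$, let $X\leq W_n$ be a subgroup, let $\alpha\in W_n\setminus X$, and set $Y=\langle X,\alpha\rangle$. Suppose $v\in\mathbb{F}_2^{2^n}$ satisfies: (1) for every $\beta\in X$ there exists $u^{(\beta)}\in\mathrm{Fix}(\Phi(Y))$ with $\alpha(v)+\alpha\beta(v)=u^{(\beta)}+\alpha\beta(u^{(\beta)})$; (2) $v\in\mathrm{Fix}(\Phi(Y))$. Then $v\in\mathrm{Fix}(\alpha)+\mathrm{Fix}(X)$.
   Context: $W_n=\mathrm{Aut}(T_n)$ is the automorphism group of the complete binary rooted tree with $n$ levels; it acts faithfully on the $2^n$ vertices of level $n$, labelled $\{1,\dots,2^n\}$. $W_n$ acts on $\mathbb{F}_2^{2^n}$ by permuting coordinates: $\sigma(v)=(v_{\sigma^{ -1}(1)},\dots,v_{\sigma^{ -1}(2^n)})$. For $\sigma\in W_n$, $\mathrm{Fix}(\sigma)=\{v\in\mathbb{F}_2^{2^n}:\sigma(v)=v\}$, and for a subgroup $S\leq W_n$, $\mathrm{Fix}(S)=\bigcap_{\sigma\in S}\mathrm{Fix}(\sigma)$; $\mathrm{Fix}(\alpha)+\mathrm{Fix}(X)$ is the sum of subspaces. $\Phi(Y)$ is the Frattini subgroup of $Y$. -}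

module Defs where

open import Data.Nat using (ℕ; zero; suc)
open import Data.Bool using (Bool; true; false; not; _xor_; if_then_else_)
open import Data.Vec using (Vec; []; _∷_)
open import Data.Product using (Σ; _×_; _,_; ∃)
open import Data.Sum using (_⊎_)
open import Relation.Binary.PropositionalEquality using (_≡_)

-- W n = Aut(T_n), represented by portraits: at each internal vertex a bit
-- saying whether the two children are swapped.  This representation is
-- faithful (distinct portraits give distinct permutations of the leaves).
data W : ℕ → Set where
  leaf : W zero
  node : {n : ℕ} → Bool → W n → W n → W (suc n)

Leaf : ℕ → Set
Leaf n = Vec Bool n

sel : {A : Set} → Bool → A → A → A
sel x l r = if x then r else l

act : {n : ℕ} → W n → Leaf n → Leaf n
act leaf [] = []
act (node b l r) (x ∷ xs) = (b xor x) ∷ act (sel x l r) xs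

-- identity, composition (σ ∘ τ acts as "first τ then σ"), inverse
e : {n : ℕ} → W n
e {zero} = leaf
e {suc n} = node false e e

_∘w_ : {n : ℕ} → W n → W n → W n
leaf ∘w leaf = leaf
node b l r ∘w node c l' r' =
  node (b xor c) (sel c l r ∘w l') (sel (not c) l r ∘w r')

inv : {n : ℕ} → W n → W n
inv leaf = leaf
inv (node b l r) = node b (inv (sel b l r)) (inv (sel (not b) l r))

-- vectors of F₂^{2^n}: functions from the leaves to Bool (addition = xor)
F2V : ℕ → Set
F2V n = Leaf n → Bool

_·_ : {n : ℕ} → W n → F2V n → F2V n
(σ · v) a = v (act (inv σ) a)

-- subsets of W n (decidable, as W n is finite)
Subset : ℕ → Set
Subset n = W n → Bool

IsSubgroup : {n : ℕ} → Subset n → Set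
IsSubgroup {n} H =
  (H e ≡ true)
  × ((g h : W n) → H g ≡ true → H h ≡ true → H (g ∘w h) ≡ true)
  × ((g : W n) → H g ≡ true → H (inv g) ≡ true)

data Gen {n : ℕ} (X : Subset n) (α : W n) : W n → Set where
  base : (g : W n) → X g ≡ true → Gen X α g
  gen  : Gen X α α
  one  : Gen X α e
  mul  : (g h : W n) → Gen X α g → Gen X α h → Gen X α (g ∘w h)
  neg  : (g : W n) → Gen X α g → Gen X α (inv g)

IsMaximalIn : {n : ℕ} → (W n → Set) → Subset n → Set
IsMaximalIn {n} Y M =
  IsSubgroup M
  × ((g : W n) → M g ≡ true → Y g)
  × (Σ (W n) λ g → Y g × M g ≡ false)
  × ((K : Subset n) → IsSubgroup K
       → ((g : W n) → M g ≡ true → K g ≡ true)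
       → ((g : W n) → K g ≡ true → Y g)
       → ((g : W n) → K g ≡ true → M g ≡ true)
         ⊎ ((g : W n) → Y g → K g ≡ true))

Frattini : {n : ℕ} → (W n → Set) → W n → Set
Frattini {n} Y g = Y g × ((M : Subset n) → IsMaximalIn Y M → M g ≡ true)

InFix : {n : ℕ} → W n → F2V n → Set
InFix {n} σ v = (a : Leaf n) → (σ · v) a ≡ v a

InFixSet : {n : ℕ} → (W n → Set) → F2V n → Set
InFixSet {n} S v = (σ : W n) → S σ → InFix σ v

InFixSum : {n : ℕ} → W n → Subset n → F2V n → Set
InFixSum {n} α X v =
  Σ (F2V n) λ w → Σ (F2V n) λ w' →
    InFix α w × InFixSet (λ β → X β ≡ true) w'
    × ((a : Leaf n) → v a ≡ (w a xor w' a))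

-- Every maximal subgroup M of a subgroup Y of W n has index two: W n carries a
-- descending series Γ ending in the identity with [Γ k , W n] and the squares
-- of Γ k inside Γ (k + 1), so passing to commutators and squares produces an
-- element outside M that normalises M and squares into M.  Hence Φ(Y) contains
-- all squares and commutators of Y, and on Fix(Φ(Y)) the group Y acts by
-- commuting involutions.  The vector d = v + α v is fixed by α, and by
-- condition (1) also by X.  Colour each leaf of an ⟨X , α⟩-orbit by the parity
-- of the number of α-moves from a base point of the orbit.  If a leaf y gets
-- both colours, then f y = (α β f) y for some β ∈ X and all f ∈ Fix(Φ(Y)), and
-- (1) forces d y = 0.  So A = d · [even colour] is X-invariant with A + α A = d,
-- and v = (v + A) + A with v + A ∈ Fix(α).
module Submission where

open import Defs
open import Algebra.Bundles using (Group)
open import Algebra.Core using (Op₁; Op₂)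
open import Algebra.Structures using (IsGroup)
import Algebra.Properties.Group as GroupProperties
open import Data.Bool using (Bool; true; false; not; _∧_; _∨_; _xor_; if_then_else_)
open import Data.Bool.Properties
  using (_≟_; xor-comm; xor-same; xor-assoc; xor-identityʳ; xor-inverseˡ; xor-inverseʳ;
         not-involutive; not-injective; ¬-not; ∧-distribˡ-xor; ⇔→≡)
open import Data.Empty using (⊥; ⊥-elim)
open import Data.List using (List; []; _∷_; length; cartesianProduct; cartesianProductWith; findᵇ)
open import Data.List.Membership.Propositional using (_∈_; lose)
open import Data.List.Membership.Propositional.Properties
  using (∈-cartesianProduct⁺; ∈-cartesianProductWith⁺)
open import Data.List.Relation.Unary.Any using (here; there; any?; satisfied)
open import Data.Maybe using (just; fromMaybe)
open import Data.Nat using (ℕ; suc; zero; _+_; _≤_; _<_; z≤n; s≤s)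
open import Data.Nat.Properties
  using (+-identityʳ; +-suc; +-mono-≤; +-mono-≤-<; ≤-trans; ≤-refl; n≮n; m≤n⇒m≤1+n)
open import Data.Product using (Σ; ∃; _×_; _,_; proj₁; proj₂)
import Data.Product.Properties as Product
open import Data.Sum using (_⊎_; inj₁; inj₂; [_,_]′)
open import Data.Unit using (⊤; tt)
open import Data.Vec using ([]; _∷_; replicate)
import Data.Vec.Properties as Vec
open import Function.Bundles using (mk⇔)
open import Level using (0ℓ)
open import Relation.Nullary using (Dec; yes; no; does)
open import Relation.Nullary.Decidable using (map′; _×-dec_; dec-true)
open import Relation.Unary using (Decidable)
open import Relation.Binary.PropositionalEquality
  using (_≡_; refl; sym; trans; cong; cong₂; subst; subst₂; isEquivalence; module ≡-Reasoning)
open ≡-Reasoning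

∨-introˡ : {a b : Bool} → a ≡ true → a ∨ b ≡ true
∨-introˡ refl = refl

∨-introʳ : (a : Bool) {b : Bool} → b ≡ true → a ∨ b ≡ true
∨-introʳ false b≡true = b≡true
∨-introʳ true _ = refl

∨-elim : (a : Bool) {b : Bool} → a ∨ b ≡ true → a ≡ true ⊎ b ≡ true
∨-elim true _ = inj₁ refl
∨-elim false b≡true = inj₂ b≡true

does-sound : {A : Set} (a? : Dec A) → does a? ≡ true → A
does-sound (yes a) _ = a

true≢false : true ≡ false → ⊥
true≢false ()

≡false-contrapositive : {a b : Bool} → (a ≡ true → b ≡ true) → b ≡ false → a ≡ false
≡false-contrapositive {false} _ _ = refl
≡false-contrapositive {true} a⇒b refl = ⊥-elim (true≢false (sym (a⇒b refl)))

xor-commutator : (b c : Bool) → ((b xor c) xor b) xor c ≡ false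
xor-commutator false false = refl
xor-commutator false true = refl
xor-commutator true false = refl
xor-commutator true true = refl

xor≡true : (a b : Bool) → (a ≡ true → b ≡ false) → (a ≡ false → b ≡ true) → a xor b ≡ true
xor≡true true true a⇒¬b _ = sym (a⇒¬b refl)
xor≡true true false _ _ = refl
xor≡true false true _ _ = refl
xor≡true false false _ ¬a⇒b = ¬a⇒b refl

⇒→∧≡ˡ : (a : Bool) {b : Bool} → (a ≡ true → b ≡ true) → a ∧ b ≡ a
⇒→∧≡ˡ false _ = refl
⇒→∧≡ˡ true a⇒b = a⇒b refl

xor-swap : (a b c d : Bool) → a xor b ≡ c xor d → a xor c ≡ b xor d
xor-swap false b false d refl = sym (xor-same d)
xor-swap false b true d refl = sym (xor-inverseˡ d)
xor-swap true b false d refl = sym (xor-inverseʳ b)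
xor-swap true b true d p rewrite not-injective p = sym (xor-same d)

module GroupIdentities {A : Set} {_·_ : Op₂ A} {ι : A} {inverse : Op₁ A}
  (isGroup : IsGroup _≡_ _·_ ι inverse) where

  private
    G : Group 0ℓ 0ℓ
    G = record { isGroup = isGroup }

  open Group G using (_∙_; ε; _⁻¹; _//_; assoc; identityʳ; inverseʳ)
  open GroupProperties G using (inverseʳ-unique; \\-leftDividesˡ)
  open GroupProperties G public using (ε⁻¹≈ε; ⁻¹-involutive; ⁻¹-anti-homo-∙; ⁻¹-anti-homo-//;
    \\-leftDividesʳ; //-rightDividesˡ; //-rightDividesʳ)

  conj : A → A → A
  conj h g = h ∙ g ∙ h ⁻¹

  ⁅_,_⁆ : A → A → A
  ⁅ g , h ⁆ = g ∙ h ∙ g ⁻¹ ∙ h ⁻¹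

  conj≡⁅⁆∙ : ∀ h g → conj h g ≡ ⁅ h , g ⁆ ∙ g
  conj≡⁅⁆∙ h g = sym (//-rightDividesˡ g (conj h g))

  ⁅⁆-anticomm : ∀ h g → ⁅ h , g ⁆ ≡ ⁅ g , h ⁆ ⁻¹
  ⁅⁆-anticomm h g = sym (begin
    (g ∙ h ∙ g ⁻¹ ∙ h ⁻¹) ⁻¹         ≡⟨ ⁻¹-anti-homo-∙ _ (h ⁻¹) ⟩
    h ⁻¹ ⁻¹ ∙ (g ∙ h ∙ g ⁻¹) ⁻¹       ≡⟨ cong₂ _∙_ (⁻¹-involutive h) (⁻¹-anti-homo-∙ (g ∙ h) (g ⁻¹)) ⟩
    h ∙ (g ⁻¹ ⁻¹ ∙ (g ∙ h) ⁻¹)        ≡⟨ cong (λ t → h ∙ (t ∙ (g ∙ h) ⁻¹)) (⁻¹-involutive g) ⟩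
    h ∙ (g ∙ (g ∙ h) ⁻¹)              ≡⟨ cong (λ t → h ∙ (g ∙ t)) (⁻¹-anti-homo-∙ g h) ⟩
    h ∙ (g ∙ (h ⁻¹ ∙ g ⁻¹))           ≡⟨ cong (h ∙_) (sym (assoc g (h ⁻¹) (g ⁻¹))) ⟩
    h ∙ (g ∙ h ⁻¹ ∙ g ⁻¹)             ≡⟨ sym (assoc h _ _) ⟩
    h ∙ (g ∙ h ⁻¹) ∙ g ⁻¹             ≡⟨ cong (_∙ g ⁻¹) (sym (assoc h g (h ⁻¹))) ⟩
    h ∙ g ∙ h ⁻¹ ∙ g ⁻¹               ∎)

  conj-homo-∙ : ∀ h g g′ → conj h g ∙ conj h g′ ≡ conj h (g ∙ g′)
  conj-homo-∙ h g g′ = begin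
    h ∙ g ∙ h ⁻¹ ∙ (h ∙ g′ ∙ h ⁻¹)     ≡⟨ assoc (h ∙ g) (h ⁻¹) _ ⟩
    h ∙ g ∙ (h ⁻¹ ∙ (h ∙ g′ ∙ h ⁻¹))   ≡⟨ cong (λ t → h ∙ g ∙ (h ⁻¹ ∙ t)) (assoc h g′ (h ⁻¹)) ⟩
    h ∙ g ∙ (h ⁻¹ ∙ (h ∙ (g′ ∙ h ⁻¹))) ≡⟨ cong (h ∙ g ∙_) (\\-leftDividesʳ h _) ⟩
    h ∙ g ∙ (g′ ∙ h ⁻¹)                ≡⟨ sym (assoc (h ∙ g) g′ (h ⁻¹)) ⟩
    h ∙ g ∙ g′ ∙ h ⁻¹                  ≡⟨ cong (_∙ h ⁻¹) (assoc h g g′) ⟩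
    h ∙ (g ∙ g′) ∙ h ⁻¹                ∎

  conj-homo-⁻¹ : ∀ h g → conj h (g ⁻¹) ≡ conj h g ⁻¹
  conj-homo-⁻¹ h g = inverseʳ-unique (conj h g) (conj h (g ⁻¹)) (begin
    conj h g ∙ conj h (g ⁻¹)  ≡⟨ conj-homo-∙ h g (g ⁻¹) ⟩
    h ∙ (g ∙ g ⁻¹) ∙ h ⁻¹     ≡⟨ cong (λ t → h ∙ t ∙ h ⁻¹) (inverseʳ g) ⟩
    h ∙ ε ∙ h ⁻¹              ≡⟨ cong (_∙ h ⁻¹) (identityʳ h) ⟩
    h ∙ h ⁻¹                  ≡⟨ inverseʳ h ⟩
    ε                         ∎)

  conj-⁅⁆ : ∀ h a b → conj h ⁅ a , b ⁆ ≡ ⁅ conj h a , conj h b ⁆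
  conj-⁅⁆ h a b = sym (begin
    conj h a ∙ conj h b ∙ conj h a ⁻¹ ∙ conj h b ⁻¹
      ≡⟨ cong₂ (λ s t → conj h a ∙ conj h b ∙ s ∙ t) (sym (conj-homo-⁻¹ h a)) (sym (conj-homo-⁻¹ h b)) ⟩
    conj h a ∙ conj h b ∙ conj h (a ⁻¹) ∙ conj h (b ⁻¹)
      ≡⟨ cong (λ s → s ∙ conj h (a ⁻¹) ∙ conj h (b ⁻¹)) (conj-homo-∙ h a b) ⟩
    conj h (a ∙ b) ∙ conj h (a ⁻¹) ∙ conj h (b ⁻¹)
      ≡⟨ cong (_∙ conj h (b ⁻¹)) (conj-homo-∙ h (a ∙ b) (a ⁻¹)) ⟩
    conj h (a ∙ b ∙ a ⁻¹) ∙ conj h (b ⁻¹)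
      ≡⟨ conj-homo-∙ h _ (b ⁻¹) ⟩
    conj h ⁅ a , b ⁆ ∎)

  ∙≡∙-conj : ∀ x g → x ∙ g ≡ g ∙ conj (g ⁻¹) x
  ∙≡∙-conj x g = sym (begin
    g ∙ (g ⁻¹ ∙ x ∙ g ⁻¹ ⁻¹)  ≡⟨ cong (λ t → g ∙ (g ⁻¹ ∙ x ∙ t)) (⁻¹-involutive g) ⟩
    g ∙ (g ⁻¹ ∙ x ∙ g)        ≡⟨ cong (g ∙_) (assoc (g ⁻¹) x g) ⟩
    g ∙ (g ⁻¹ ∙ (x ∙ g))      ≡⟨ \\-leftDividesˡ g _ ⟩
    x ∙ g                     ∎)

  ∙-comm-up-to-⁅⁆ : ∀ a b → a ∙ b ≡ b ∙ a ∙ ⁅ a ⁻¹ , b ⁻¹ ⁆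
  ∙-comm-up-to-⁅⁆ a b = sym (begin
    b ∙ a ∙ (a ⁻¹ ∙ b ⁻¹ ∙ a ⁻¹ ⁻¹ ∙ b ⁻¹ ⁻¹)
      ≡⟨ cong₂ (λ s t → b ∙ a ∙ (a ⁻¹ ∙ b ⁻¹ ∙ s ∙ t)) (⁻¹-involutive a) (⁻¹-involutive b) ⟩
    b ∙ a ∙ (a ⁻¹ ∙ b ⁻¹ ∙ a ∙ b)
      ≡⟨ cong (b ∙ a ∙_) (trans (cong (_∙ b) (assoc (a ⁻¹) (b ⁻¹) a)) (assoc (a ⁻¹) _ b)) ⟩
    b ∙ a ∙ (a ⁻¹ ∙ (b ⁻¹ ∙ a ∙ b))  ≡⟨ assoc b a _ ⟩
    b ∙ (a ∙ (a ⁻¹ ∙ (b ⁻¹ ∙ a ∙ b))) ≡⟨ cong (b ∙_) (\\-leftDividesˡ a _) ⟩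
    b ∙ (b ⁻¹ ∙ a ∙ b)               ≡⟨ cong (b ∙_) (assoc (b ⁻¹) a b) ⟩
    b ∙ (b ⁻¹ ∙ (a ∙ b))             ≡⟨ \\-leftDividesˡ b _ ⟩
    a ∙ b                            ∎)

  //-∙-∙ : ∀ l l′ r r′ → l ∙ l′ // (r ∙ r′) ≡ conj l (l′ // r′) ∙ (l // r)
  //-∙-∙ l l′ r r′ = sym (begin
    l ∙ (l′ ∙ r′ ⁻¹) ∙ l ⁻¹ ∙ (l ∙ r ⁻¹)   ≡⟨ assoc _ (l ⁻¹) _ ⟩
    l ∙ (l′ ∙ r′ ⁻¹) ∙ (l ⁻¹ ∙ (l ∙ r ⁻¹)) ≡⟨ cong (l ∙ (l′ ∙ r′ ⁻¹) ∙_) (\\-leftDividesʳ l (r ⁻¹)) ⟩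
    l ∙ (l′ ∙ r′ ⁻¹) ∙ r ⁻¹                ≡⟨ cong (_∙ r ⁻¹) (sym (assoc l l′ (r′ ⁻¹))) ⟩
    l ∙ l′ ∙ r′ ⁻¹ ∙ r ⁻¹                  ≡⟨ assoc _ (r′ ⁻¹) (r ⁻¹) ⟩
    l ∙ l′ ∙ (r′ ⁻¹ ∙ r ⁻¹)                ≡⟨ cong (l ∙ l′ ∙_) (sym (⁻¹-anti-homo-∙ r r′)) ⟩
    l ∙ l′ ∙ (r ∙ r′) ⁻¹                   ∎)

  ⁻¹-//-⁻¹ : ∀ l r → l ⁻¹ // r ⁻¹ ≡ conj (l ⁻¹) ((l // r) ⁻¹)
  ⁻¹-//-⁻¹ l r = sym (begin
    l ⁻¹ ∙ (l ∙ r ⁻¹) ⁻¹ ∙ l ⁻¹ ⁻¹        ≡⟨ cong₂ (λ s t → l ⁻¹ ∙ s ∙ t) (⁻¹-anti-homo-∙ l (r ⁻¹)) (⁻¹-involutive l) ⟩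
    l ⁻¹ ∙ (r ⁻¹ ⁻¹ ∙ l ⁻¹) ∙ l            ≡⟨ cong (_∙ l) (sym (assoc (l ⁻¹) (r ⁻¹ ⁻¹) (l ⁻¹))) ⟩
    l ⁻¹ ∙ r ⁻¹ ⁻¹ ∙ l ⁻¹ ∙ l              ≡⟨ //-rightDividesˡ l _ ⟩
    l ⁻¹ ∙ r ⁻¹ ⁻¹                         ∎)

  ∙//-⁅⁆ : ∀ l r r′ → l ∙ r′ // r // r′ ≡ (l // r) ∙ ⁅ r , r′ ⁆
  ∙//-⁅⁆ l r r′ = begin
    l ∙ r′ ∙ r ⁻¹ ∙ r′ ⁻¹                 ≡⟨ trans (cong (_∙ r′ ⁻¹) (assoc l r′ (r ⁻¹))) (assoc l _ _) ⟩
    l ∙ (r′ ∙ r ⁻¹ ∙ r′ ⁻¹)               ≡⟨ cong (_∙ (r′ ∙ r ⁻¹ ∙ r′ ⁻¹)) (sym (//-rightDividesˡ r l)) ⟩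
    l ∙ r ⁻¹ ∙ r ∙ (r′ ∙ r ⁻¹ ∙ r′ ⁻¹)    ≡⟨ assoc (l ∙ r ⁻¹) r _ ⟩
    l ∙ r ⁻¹ ∙ (r ∙ (r′ ∙ r ⁻¹ ∙ r′ ⁻¹))  ≡⟨ cong (l ∙ r ⁻¹ ∙_) (sym (trans (cong (_∙ r′ ⁻¹) (assoc r r′ (r ⁻¹))) (assoc r _ _))) ⟩
    l ∙ r ⁻¹ ∙ ⁅ r , r′ ⁆                 ∎

  ∙-//-⁻¹∙ : ∀ x c c′ → x ∙ c // (x ⁻¹ ∙ c′) ≡ conj x (c // c′) ∙ (x ∙ x)
  ∙-//-⁻¹∙ x c c′ = sym (begin
    x ∙ (c ∙ c′ ⁻¹) ∙ x ⁻¹ ∙ (x ∙ x)      ≡⟨ assoc _ (x ⁻¹) _ ⟩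
    x ∙ (c ∙ c′ ⁻¹) ∙ (x ⁻¹ ∙ (x ∙ x))    ≡⟨ cong (x ∙ (c ∙ c′ ⁻¹) ∙_) (\\-leftDividesʳ x x) ⟩
    x ∙ (c ∙ c′ ⁻¹) ∙ x                   ≡⟨ cong (_∙ x) (sym (assoc x c (c′ ⁻¹))) ⟩
    x ∙ c ∙ c′ ⁻¹ ∙ x                     ≡⟨ assoc _ (c′ ⁻¹) x ⟩
    x ∙ c ∙ (c′ ⁻¹ ∙ x)                   ≡⟨ cong (λ t → x ∙ c ∙ (c′ ⁻¹ ∙ t)) (sym (⁻¹-involutive x)) ⟩
    x ∙ c ∙ (c′ ⁻¹ ∙ x ⁻¹ ⁻¹)             ≡⟨ cong (x ∙ c ∙_) (sym (⁻¹-anti-homo-∙ (x ⁻¹) c′)) ⟩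
    x ∙ c ∙ (x ⁻¹ ∙ c′) ⁻¹                ∎)

  //∙conj : ∀ x z w → (x // z) ∙ conj z w ≡ x ∙ w // z
  //∙conj x z w = begin
    x ∙ z ⁻¹ ∙ (z ∙ w ∙ z ⁻¹)    ≡⟨ sym (assoc _ (z ∙ w) (z ⁻¹)) ⟩
    x ∙ z ⁻¹ ∙ (z ∙ w) ∙ z ⁻¹    ≡⟨ cong (_∙ z ⁻¹) (assoc x (z ⁻¹) _) ⟩
    x ∙ (z ⁻¹ ∙ (z ∙ w)) ∙ z ⁻¹  ≡⟨ cong (λ t → x ∙ t ∙ z ⁻¹) (\\-leftDividesʳ z w) ⟩
    x ∙ w ∙ z ⁻¹                 ∎

  ∙≡//∙conj//∙² : ∀ x x′ z → x ∙ x′ ≡ (x // z) ∙ conj z (x′ // z) ∙ (z ∙ z)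
  ∙≡//∙conj//∙² x x′ z = sym (begin
    (x // z) ∙ conj z (x′ // z) ∙ (z ∙ z) ≡⟨ cong (_∙ (z ∙ z)) (//∙conj x z (x′ // z)) ⟩
    (x ∙ (x′ // z) // z) ∙ (z ∙ z)      ≡⟨ assoc _ (z ⁻¹) _ ⟩
    x ∙ (x′ // z) ∙ (z ⁻¹ ∙ (z ∙ z))    ≡⟨ cong (x ∙ (x′ // z) ∙_) (\\-leftDividesʳ z z) ⟩
    x ∙ (x′ // z) ∙ z                   ≡⟨ assoc x _ z ⟩
    x ∙ ((x′ // z) ∙ z)                 ≡⟨ cong (x ∙_) (//-rightDividesˡ z x′) ⟩
    x ∙ x′                              ∎)

node-cong : {n : ℕ} {b b' : Bool} {l l' r r' : W n} →
            b ≡ b' → l ≡ l' → r ≡ r' → node b l r ≡ node b' l' r'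
node-cong refl refl refl = refl

∘w-assoc : {n : ℕ} (g h k : W n) → (g ∘w h) ∘w k ≡ g ∘w (h ∘w k)
∘w-assoc leaf leaf leaf = refl
∘w-assoc (node b l r) (node false l' r') (node false l'' r'') =
  node-cong (xor-assoc b false false) (∘w-assoc l l' l'') (∘w-assoc r r' r'')
∘w-assoc (node b l r) (node false l' r') (node true l'' r'') =
  node-cong (xor-assoc b false true) (∘w-assoc r r' l'') (∘w-assoc l l' r'')
∘w-assoc (node b l r) (node true l' r') (node false l'' r'') =
  node-cong (xor-assoc b true false) (∘w-assoc r l' l'') (∘w-assoc l r' r'')
∘w-assoc (node b l r) (node true l' r') (node true l'' r'') =
  node-cong (xor-assoc b true true) (∘w-assoc l r' l'') (∘w-assoc r l' r'')

∘w-identityˡ : {n : ℕ} (g : W n) → e ∘w g ≡ g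
∘w-identityˡ leaf = refl
∘w-identityˡ (node false l r) = node-cong refl (∘w-identityˡ l) (∘w-identityˡ r)
∘w-identityˡ (node true l r) = node-cong refl (∘w-identityˡ l) (∘w-identityˡ r)

∘w-identityʳ : {n : ℕ} (g : W n) → g ∘w e ≡ g
∘w-identityʳ leaf = refl
∘w-identityʳ (node b l r) = node-cong (xor-identityʳ b) (∘w-identityʳ l) (∘w-identityʳ r)

∘w-inverseˡ : {n : ℕ} (g : W n) → inv g ∘w g ≡ e
∘w-inverseˡ leaf = refl
∘w-inverseˡ (node false l r) = node-cong refl (∘w-inverseˡ l) (∘w-inverseˡ r)
∘w-inverseˡ (node true l r) = node-cong refl (∘w-inverseˡ l) (∘w-inverseˡ r)

∘w-inverseʳ : {n : ℕ} (g : W n) → g ∘w inv g ≡ e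
∘w-inverseʳ leaf = refl
∘w-inverseʳ (node false l r) = node-cong refl (∘w-inverseʳ l) (∘w-inverseʳ r)
∘w-inverseʳ (node true l r) = node-cong refl (∘w-inverseʳ r) (∘w-inverseʳ l)

W-isGroup : (n : ℕ) → IsGroup _≡_ (_∘w_ {n}) e inv
W-isGroup n = record
  { isMonoid = record
    { isSemigroup = record
      { isMagma = record { isEquivalence = isEquivalence ; ∙-cong = cong₂ _∘w_ }
      ; assoc = ∘w-assoc
      }
    ; identity = ∘w-identityˡ , ∘w-identityʳ
    }
  ; inverse = ∘w-inverseˡ , ∘w-inverseʳ
  ; ⁻¹-cong = cong inv
  }

act-∘w : {n : ℕ} (g h : W n) (x : Leaf n) → act (g ∘w h) x ≡ act g (act h x)
act-∘w leaf leaf [] = refl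
act-∘w (node b l r) (node false l' r') (false ∷ xs) = cong₂ _∷_ (xor-assoc b false false) (act-∘w l l' xs)
act-∘w (node b l r) (node false l' r') (true ∷ xs) = cong₂ _∷_ (xor-assoc b false true) (act-∘w r r' xs)
act-∘w (node b l r) (node true l' r') (false ∷ xs) = cong₂ _∷_ (xor-assoc b true false) (act-∘w r l' xs)
act-∘w (node b l r) (node true l' r') (true ∷ xs) = cong₂ _∷_ (xor-assoc b true true) (act-∘w l r' xs)

act-e : {n : ℕ} (x : Leaf n) → act e x ≡ x
act-e [] = refl
act-e (false ∷ xs) = cong (false ∷_) (act-e xs)
act-e (true ∷ xs) = cong (true ∷_) (act-e xs)

module _ {n : ℕ} where
  open GroupIdentities (W-isGroup n) public

next : ℕ × Bool → ℕ × Bool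
next (i , false) = i , true
next (i , true) = suc i , false

halve : ℕ → ℕ × Bool
halve zero = 0 , false
halve (suc k) = next (halve k)

halve-+ : (i : ℕ) → halve (i + i) ≡ (i , false)
halve-+ zero = refl
halve-+ (suc i) rewrite +-suc i i | halve-+ i = refl

-- A central series of W n

-- Γ n 0 = W n, commutators with W n and squares of elements of Γ n k lie in
-- Γ n (suc k), and Γ n (depth n) is trivial.  For W (suc n) = (W n × W n) ⋊ C₂
-- its terms come in pairs indexed by halve k = (i , p): both halves in Γ n i
-- and the root unswapped, and for p = true also l r⁻¹ ∈ Γ n (suc i).
mutual
  Γ : (n k : ℕ) → W n → Set
  Γ zero k leaf = ⊤
  Γ (suc n) zero g = ⊤
  Γ (suc n) (suc k) g = Γ-node n (halve k) g

  Γ-node : (n : ℕ) → ℕ × Bool → W (suc n) → Set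
  Γ-node n (i , false) (node b l r) = b ≡ false × Γ n i l × Γ n i r
  Γ-node n (i , true) (node b l r) = b ≡ false × Γ n i l × Γ n i r × Γ n (suc i) (l ∘w inv r)

mutual
  Γ-all : (n : ℕ) (g : W n) → Γ n 0 g
  Γ-all zero leaf = tt
  Γ-all (suc n) g = tt

  Γ-e : (n k : ℕ) → Γ n k e
  Γ-e zero k = tt
  Γ-e (suc n) zero = tt
  Γ-e (suc n) (suc k) = Γ-node-e n (halve k)

  Γ-node-e : (n : ℕ) (p : ℕ × Bool) → Γ-node n p e
  Γ-node-e n (i , false) = refl , Γ-e n i , Γ-e n i
  Γ-node-e n (i , true) =
    refl , Γ-e n i , Γ-e n i , subst (Γ n (suc i)) (sym (∘w-inverseʳ e)) (Γ-e n (suc i))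

  Γ-∘ : (n k : ℕ) {g h : W n} → Γ n k g → Γ n k h → Γ n k (g ∘w h)
  Γ-∘ zero k {leaf} {leaf} _ _ = tt
  Γ-∘ (suc n) zero _ _ = tt
  Γ-∘ (suc n) (suc k) γg γh = Γ-node-∘ n (halve k) γg γh

  Γ-node-∘ : (n : ℕ) (p : ℕ × Bool) {g h : W (suc n)} →
             Γ-node n p g → Γ-node n p h → Γ-node n p (g ∘w h)
  Γ-node-∘ n (i , false) {node _ l r} {node _ l′ r′} (refl , γl , γr) (refl , γl′ , γr′) =
    refl , Γ-∘ n i γl γl′ , Γ-∘ n i γr γr′
  Γ-node-∘ n (i , true) {node _ l r} {node _ l′ r′} (refl , γl , γr , γ) (refl , γl′ , γr′ , γ′) =
    refl , Γ-∘ n i γl γl′ , Γ-∘ n i γr γr′ ,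
    subst (Γ n (suc i)) (sym (//-∙-∙ l l′ r r′)) (Γ-∘ n (suc i) (Γ-conj n (suc i) l γ′) γ)

  Γ-inv : (n k : ℕ) {g : W n} → Γ n k g → Γ n k (inv g)
  Γ-inv zero k {leaf} _ = tt
  Γ-inv (suc n) zero _ = tt
  Γ-inv (suc n) (suc k) γ = Γ-node-inv n (halve k) γ

  Γ-node-inv : (n : ℕ) (p : ℕ × Bool) {g : W (suc n)} → Γ-node n p g → Γ-node n p (inv g)
  Γ-node-inv n (i , false) {node _ l r} (refl , γl , γr) = refl , Γ-inv n i γl , Γ-inv n i γr
  Γ-node-inv n (i , true) {node _ l r} (refl , γl , γr , γ) =
    refl , Γ-inv n i γl , Γ-inv n i γr ,
    subst (Γ n (suc i)) (sym (⁻¹-//-⁻¹ l r)) (Γ-conj n (suc i) (inv l) (Γ-inv n (suc i) γ))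

  Γ-weaken : (n k : ℕ) {g : W n} → Γ n (suc k) g → Γ n k g
  Γ-weaken zero k {leaf} _ = tt
  Γ-weaken (suc n) zero _ = tt
  Γ-weaken (suc n) (suc k) γ = Γ-node-weaken n (halve k) γ

  Γ-node-weaken : (n : ℕ) (p : ℕ × Bool) {g : W (suc n)} → Γ-node n (next p) g → Γ-node n p g
  Γ-node-weaken n (i , false) {node _ l r} (refl , γl , γr , _) = refl , γl , γr
  Γ-node-weaken n (i , true) {node _ l r} (refl , γl , γr) =
    refl , Γ-weaken n i γl , Γ-weaken n i γr , Γ-∘ n (suc i) γl (Γ-inv n (suc i) γr)

  Γ-⁅⁆ : (n k : ℕ) {g : W n} → Γ n k g → (h : W n) → Γ n (suc k) ⁅ g , h ⁆
  Γ-⁅⁆ zero k {leaf} _ leaf = tt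
  Γ-⁅⁆ (suc n) zero {node b l r} _ (node c l′ r′) =
    xor-commutator b c , Γ-all n _ , Γ-all n _
  Γ-⁅⁆ (suc n) (suc k) γ h = Γ-node-⁅⁆ n (halve k) γ h

  Γ-node-⁅⁆ : (n : ℕ) (p : ℕ × Bool) {g : W (suc n)} → Γ-node n p g →
              (h : W (suc n)) → Γ-node n (next p) ⁅ g , h ⁆
  Γ-node-⁅⁆ n (i , false) {node _ l r} (refl , γl , γr) (node false l′ r′) =
    refl , Γ-weaken n i (Γ-⁅⁆ n i γl l′) , Γ-weaken n i (Γ-⁅⁆ n i γr r′) ,
    Γ-∘ n (suc i) (Γ-⁅⁆ n i γl l′) (Γ-inv n (suc i) (Γ-⁅⁆ n i γr r′))
  Γ-node-⁅⁆ n (i , true) {node _ l r} (refl , γl , γr , _) (node false l′ r′) =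
    refl , Γ-⁅⁆ n i γl l′ , Γ-⁅⁆ n i γr r′
  Γ-node-⁅⁆ n (i , false) {node _ l r} (refl , γl , γr) (node true l′ r′) =
    refl ,
    subst (Γ n i) (sym (∙//-⁅⁆ l r r′)) (Γ-∘ n i γx (Γ-weaken n i (Γ-⁅⁆ n i γr r′))) ,
    subst (Γ n i) (sym (∙//-⁅⁆ r l l′))
      (Γ-∘ n i (subst (Γ n i) (⁻¹-anti-homo-// l r) (Γ-inv n i γx)) (Γ-weaken n i (Γ-⁅⁆ n i γl l′))) ,
    subst (Γ n (suc i)) swapped
      (Γ-∘ n (suc i)
        (Γ-conj n (suc i) x (Γ-∘ n (suc i) (Γ-⁅⁆ n i γr r′) (Γ-inv n (suc i) (Γ-⁅⁆ n i γl l′))))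
        (Γ-square n i γx))
    where
    x = l ∘w inv r
    γx : Γ n i x
    γx = Γ-∘ n i γl (Γ-inv n i γr)
    swapped : conj x (⁅ r , r′ ⁆ ∘w inv ⁅ l , l′ ⁆) ∘w (x ∘w x)
              ≡ (((l ∘w r′) ∘w inv r) ∘w inv r′) ∘w inv (((r ∘w l′) ∘w inv l) ∘w inv l′)
    swapped = trans (sym (∙-//-⁻¹∙ x ⁅ r , r′ ⁆ ⁅ l , l′ ⁆))
      (cong₂ (λ s t → s ∘w inv t) (sym (∙//-⁅⁆ l r r′))
        (trans (cong (_∘w ⁅ l , l′ ⁆) (⁻¹-anti-homo-// l r)) (sym (∙//-⁅⁆ r l l′))))
  Γ-node-⁅⁆ n (i , true) {node _ l r} (refl , γl , γr , γ) (node true l′ r′) =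
    refl ,
    subst (Γ n (suc i)) (sym (∙//-⁅⁆ l r r′)) (Γ-∘ n (suc i) γ (Γ-⁅⁆ n i γr r′)) ,
    subst (Γ n (suc i)) (sym (∙//-⁅⁆ r l l′))
      (Γ-∘ n (suc i) (subst (Γ n (suc i)) (⁻¹-anti-homo-// l r) (Γ-inv n (suc i) γ)) (Γ-⁅⁆ n i γl l′))

  Γ-square : (n k : ℕ) {g : W n} → Γ n k g → Γ n (suc k) (g ∘w g)
  Γ-square zero k {leaf} _ = tt
  Γ-square (suc n) zero {node b l r} _ = xor-same b , Γ-all n _ , Γ-all n _
  Γ-square (suc n) (suc k) γ = Γ-node-square n (halve k) γ

  Γ-node-square : (n : ℕ) (p : ℕ × Bool) {g : W (suc n)} → Γ-node n p g → Γ-node n (next p) (g ∘w g)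
  Γ-node-square n (i , false) {node _ l r} (refl , γl , γr) =
    refl , Γ-weaken n i (Γ-square n i γl) , Γ-weaken n i (Γ-square n i γr) ,
    Γ-∘ n (suc i) (Γ-square n i γl) (Γ-inv n (suc i) (Γ-square n i γr))
  Γ-node-square n (i , true) {node _ l r} (refl , γl , γr , _) =
    refl , Γ-square n i γl , Γ-square n i γr

  Γ-conj : (n k : ℕ) (h : W n) {g : W n} → Γ n k g → Γ n k (conj h g)
  Γ-conj n k h {g} γ = subst (Γ n k) (sym (trans (conj≡⁅⁆∙ h g) (cong (_∘w g) (⁅⁆-anticomm h g))))
    (Γ-∘ n k (Γ-inv n k (Γ-weaken n k (Γ-⁅⁆ n k γ h))) γ)

depth : ℕ → ℕ
depth zero = zero
depth (suc n) = suc (depth n + depth n)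

Γ-depth : (n : ℕ) {g : W n} → Γ n (depth n) g → g ≡ e
Γ-depth zero {leaf} _ = refl
Γ-depth (suc n) {node b l r} γ with refl , γl , γr ← subst (λ p → Γ-node n p (node b l r)) (halve-+ (depth n)) γ =
  node-cong refl (Γ-depth n γl) (Γ-depth n γr)

module _ {A : Set} {P : A → Bool} where

  findᵇ-cong : {Q : A → Bool} → (∀ x → P x ≡ Q x) → (xs : List A) → findᵇ P xs ≡ findᵇ Q xs
  findᵇ-cong P≗Q [] = refl
  findᵇ-cong P≗Q (x ∷ xs) rewrite P≗Q x | findᵇ-cong P≗Q xs = refl

  findᵇ-complete : {x : A} (xs : List A) → x ∈ xs → P x ≡ true → ∃ λ y → findᵇ P xs ≡ just y × P y ≡ true
  findᵇ-complete (y ∷ ys) x∈ Px with P y in Py | x∈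
  ... | true | _ = y , refl , Py
  ... | false | here refl = ⊥-elim (true≢false (trans (sym Px) Py))
  ... | false | there x∈ys = findᵇ-complete ys x∈ys Px

module Search {A : Set} (elements : List A) (complete : (x : A) → x ∈ elements) where

  ∃? : {P : A → Set} → Decidable P → Dec (∃ P)
  ∃? P? = map′ satisfied (λ (x , px) → lose (complete x) px) (any? P? elements)

  choose : (A → Bool) → A → A
  choose P default = fromMaybe default (findᵇ P elements)

  choose-cong : {P Q : A → Bool} → (∀ x → P x ≡ Q x) → (default : A) → choose P default ≡ choose Q default
  choose-cong P≗Q default = cong (fromMaybe default) (findᵇ-cong P≗Q elements)

  choose-sound : {P : A → Bool} {x : A} → P x ≡ true → (default : A) → P (choose P default) ≡ true
  choose-sound {P} {x} Px default with y , found , Py ← findᵇ-complete elements (complete x) Px =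
    subst (λ m → P (fromMaybe default m) ≡ true) (sym found) Py

bools : List Bool
bools = true ∷ false ∷ []

∈-bools : (b : Bool) → b ∈ bools
∈-bools true = here refl
∈-bools false = there (here refl)

all-W : (n : ℕ) → List (W n)
all-W zero = leaf ∷ []
all-W (suc n) = cartesianProductWith (λ (b , l) r → node b l r) (cartesianProduct bools (all-W n)) (all-W n)

∈-all-W : {n : ℕ} (g : W n) → g ∈ all-W n
∈-all-W leaf = here refl
∈-all-W (node b l r) =
  ∈-cartesianProductWith⁺ (λ (b , l) r → node b l r) (∈-cartesianProduct⁺ (∈-bools b) (∈-all-W l)) (∈-all-W r)

all-Leaf : (n : ℕ) → List (Leaf n)
all-Leaf zero = [] ∷ []
all-Leaf (suc n) = cartesianProductWith _∷_ bools (all-Leaf n)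

∈-all-Leaf : {n : ℕ} (x : Leaf n) → x ∈ all-Leaf n
∈-all-Leaf [] = here refl
∈-all-Leaf (b ∷ x) = ∈-cartesianProductWith⁺ _∷_ (∈-bools b) (∈-all-Leaf x)

-- Maximal subgroups of subgroups of W n

module Subgroup {n : ℕ} {H : Subset n} (H-subgroup : IsSubgroup H) where

  ∋-e : H e ≡ true
  ∋-e = proj₁ H-subgroup

  ∋-∘ : {g h : W n} → H g ≡ true → H h ≡ true → H (g ∘w h) ≡ true
  ∋-∘ = proj₁ (proj₂ H-subgroup) _ _

  ∋-inv : {g : W n} → H g ≡ true → H (inv g) ≡ true
  ∋-inv = proj₂ (proj₂ H-subgroup) _

  ∋-≡ : {g h : W n} → g ≡ h → H g ≡ true → H h ≡ true
  ∋-≡ refl p = p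

  ∋-inv≡ : (g : W n) → H (inv g) ≡ H g
  ∋-inv≡ g = ⇔→≡ (mk⇔ (λ p → ∋-≡ (⁻¹-involutive g) (∋-inv p)) ∋-inv)

module MaximalSubgroup {n : ℕ} {Y : W n → Set}
  (Y-∘ : {g h : W n} → Y g → Y h → Y (g ∘w h)) (Y-inv : {g : W n} → Y g → Y (inv g))
  {M : Subset n} (M-maximal : IsMaximalIn Y M) where

  open Subgroup (proj₁ M-maximal)
  open Search (all-W n) ∈-all-W

  M⊆Y : (g : W n) → M g ≡ true → Y g
  M⊆Y = proj₁ (proj₂ M-maximal)

  Y⊈M : Σ (W n) λ g → Y g × M g ≡ false
  Y⊈M = proj₁ (proj₂ (proj₂ M-maximal))

  Normalizes : W n → Set
  Normalizes z = (m : W n) → M m ≡ true → M (conj z m) ≡ true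

  -- An element outside M normalising M with square in M; it is found by
  -- repeatedly passing to a commutator or a square, which goes one step down
  -- the series Γ and so must stop before reaching the trivial group.
  Witness : Set
  Witness = Σ (W n) λ z → Y z × M z ≡ false × Normalizes z × M (z ∘w z) ≡ true

  descend : (f k : ℕ) → f + k ≡ depth n → {y : W n} → Γ n k y → Y y → M y ≡ false → Witness
  descend zero _ refl γ _ y∉M = ⊥-elim (true≢false (trans (sym (∋-≡ (sym (Γ-depth n γ)) ∋-e)) y∉M))
  descend (suc f) k f+k≡depth {y} γ Yy y∉M
    with ∃? (λ m → (M m ≟ true) ×-dec (M (conj y m) ≟ false)) | M (y ∘w y) in y²∈M
  ... | yes (m , m∈M , ym∉M) | _ =
    descend f (suc k) (trans (+-suc f k) f+k≡depth) (Γ-⁅⁆ n k γ m) (Y-∘ (Y-∘ (Y-∘ Yy Ym) (Y-inv Yy)) (Y-inv Ym))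
      (≡false-contrapositive (λ c∈M → ∋-≡ (sym (conj≡⁅⁆∙ y m)) (∋-∘ c∈M m∈M)) ym∉M)
    where
    Ym : Y m
    Ym = M⊆Y m m∈M
  ... | no _ | false = descend f (suc k) (trans (+-suc f k) f+k≡depth) (Γ-square n k γ) (Y-∘ Yy Yy) y²∈M
  ... | no ∄m | true = y , Yy , y∉M , normalizes , y²∈M
    where
    normalizes : Normalizes y
    normalizes m m∈M with M (conj y m) in ym
    ... | true = refl
    ... | false = ⊥-elim (∄m (m , m∈M , ym))

  witness : Witness
  witness = descend (depth n) 0 (+-identityʳ (depth n)) (Γ-all n (proj₁ Y⊈M)) (proj₁ (proj₂ Y⊈M)) (proj₂ (proj₂ Y⊈M))


  module IndexTwo (z : W n) (Yz : Y z) (z∉M : M z ≡ false)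
    (z-normalizes : Normalizes z) (z²∈M : M (z ∘w z) ≡ true) where

    M∪Mz : Subset n
    M∪Mz x = M x ∨ M (x ∘w inv z)

    M∪Mz-∘ : (x x′ : W n) → M∪Mz x ≡ true → M∪Mz x′ ≡ true → M∪Mz (x ∘w x′) ≡ true
    M∪Mz-∘ x x′ p p′ with ∨-elim (M x) p | ∨-elim (M x′) p′
    ... | inj₁ x∈M | inj₁ x′∈M = ∨-introˡ (∋-∘ x∈M x′∈M)
    ... | inj₁ x∈M | inj₂ x′∈Mz = ∨-introʳ (M (x ∘w x′)) (∋-≡ (sym (∘w-assoc x x′ (inv z))) (∋-∘ x∈M x′∈Mz))
    ... | inj₂ x∈Mz | inj₁ x′∈M = ∨-introʳ (M (x ∘w x′)) (∋-≡ (//∙conj x z x′) (∋-∘ x∈Mz (z-normalizes x′ x′∈M)))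
    ... | inj₂ x∈Mz | inj₂ x′∈Mz =
      ∨-introˡ (∋-≡ (sym (∙≡//∙conj//∙² x x′ z)) (∋-∘ (∋-∘ x∈Mz (z-normalizes _ x′∈Mz)) z²∈M))

    M∪Mz-inv : (x : W n) → M∪Mz x ≡ true → M∪Mz (inv x) ≡ true
    M∪Mz-inv x p with ∨-elim (M x) p
    ... | inj₁ x∈M = ∨-introˡ (∋-inv x∈M)
    ... | inj₂ x∈Mz = ∨-introʳ (M (inv x)) (∋-≡ (⁻¹-anti-homo-∙ z x) (∋-inv zx∈M))
      where
      zx∈M : M (z ∘w x) ≡ true
      zx∈M = ∋-≡ (sym (∙≡//∙conj//∙² z x z))
        (∋-∘ (∋-∘ (∋-≡ (sym (∘w-inverseʳ z)) ∋-e) (z-normalizes _ x∈Mz)) z²∈M)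

    M∪Mz⊆Y : (x : W n) → M∪Mz x ≡ true → Y x
    M∪Mz⊆Y x p with ∨-elim (M x) p
    ... | inj₁ x∈M = M⊆Y x x∈M
    ... | inj₂ x∈Mz = subst Y (//-rightDividesˡ z x) (Y-∘ (M⊆Y _ x∈Mz) Yz)

    Y⊆M∪Mz : (x : W n) → Y x → M∪Mz x ≡ true
    Y⊆M∪Mz with proj₂ (proj₂ (proj₂ M-maximal)) M∪Mz (∨-introˡ ∋-e , M∪Mz-∘ , M∪Mz-inv)
                  (λ g → ∨-introˡ) M∪Mz⊆Y
    ... | inj₂ Y⊆ = Y⊆
    ... | inj₁ ⊆M = ⊥-elim (true≢false (trans (sym (⊆M z (∨-introʳ (M z) (∋-≡ (sym (∘w-inverseʳ z)) ∋-e)))) z∉M))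

    -- M has index two in Y: membership in M is a parity.
    odd-∘ : {a b : W n} → Y a → Y b → not (M (a ∘w b)) ≡ not (M a) xor not (M b)
    odd-∘ {a} {b} Ya Yb with M a in a∈M | M b in b∈M
    ... | true | true = cong not (∋-∘ a∈M b∈M)
    ... | true | false = cong not (≡false-contrapositive
            (λ ab∈M → ∋-≡ (\\-leftDividesʳ a b) (∋-∘ (∋-inv a∈M) ab∈M)) b∈M)
    ... | false | true = cong not (≡false-contrapositive
            (λ ab∈M → ∋-≡ (//-rightDividesʳ b a) (∋-∘ ab∈M (∋-inv b∈M))) a∈M)
    ... | false | false with ∨-elim (M a) (Y⊆M∪Mz a Ya) | ∨-elim (M b) (Y⊆M∪Mz b Yb)
    ...   | inj₁ a∈M′ | _ = ⊥-elim (true≢false (trans (sym a∈M′) a∈M))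
    ...   | _ | inj₁ b∈M′ = ⊥-elim (true≢false (trans (sym b∈M′) b∈M))
    ...   | inj₂ a∈Mz | inj₂ b∈Mz =
      cong not (∋-≡ (sym (∙≡//∙conj//∙² a b z)) (∋-∘ (∋-∘ a∈Mz (z-normalizes _ b∈Mz)) z²∈M))

    M-square : {a : W n} → Y a → M (a ∘w a) ≡ true
    M-square {a} Ya = not-injective (trans (odd-∘ Ya Ya) (xor-same (not (M a))))

    M-⁅⁆ : {a b : W n} → Y a → Y b → M ⁅ a , b ⁆ ≡ true
    M-⁅⁆ {a} {b} Ya Yb = not-injective (begin
      not (M ⁅ a , b ⁆)
        ≡⟨ odd-∘ (Y-∘ (Y-∘ Ya Yb) (Y-inv Ya)) (Y-inv Yb) ⟩
      not (M ((a ∘w b) ∘w inv a)) xor not (M (inv b))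
        ≡⟨ cong (_xor not (M (inv b))) (odd-∘ (Y-∘ Ya Yb) (Y-inv Ya)) ⟩
      (not (M (a ∘w b)) xor not (M (inv a))) xor not (M (inv b))
        ≡⟨ cong₂ (λ s t → (s xor t) xor not (M (inv b))) (odd-∘ Ya Yb) (cong not (∋-inv≡ a)) ⟩
      ((not (M a) xor not (M b)) xor not (M a)) xor not (M (inv b))
        ≡⟨ cong (λ t → ((not (M a) xor not (M b)) xor not (M a)) xor not t) (∋-inv≡ b) ⟩
      ((not (M a) xor not (M b)) xor not (M a)) xor not (M b)
        ≡⟨ xor-commutator (not (M a)) (not (M b)) ⟩
      false ∎)

  M-square : {a : W n} → Y a → M (a ∘w a) ≡ true
  M-square with z , Yz , z∉M , z-normalizes , z²∈M ← witness = IndexTwo.M-square z Yz z∉M z-normalizes z²∈M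

  M-⁅⁆ : {a b : W n} → Y a → Y b → M ⁅ a , b ⁆ ≡ true
  M-⁅⁆ with z , Yz , z∉M , z-normalizes , z²∈M ← witness = IndexTwo.M-⁅⁆ z Yz z∉M z-normalizes z²∈M

act-inv-act : {n : ℕ} (g : W n) (x : Leaf n) → act (inv g) (act g x) ≡ x
act-inv-act g x = trans (sym (act-∘w (inv g) g x)) (trans (cong (λ t → act t x) (∘w-inverseˡ g)) (act-e x))

act-act-inv : {n : ℕ} (g : W n) (x : Leaf n) → act g (act (inv g) x) ≡ x
act-act-inv g x = trans (sym (act-∘w g (inv g) x)) (trans (cong (λ t → act t x) (∘w-inverseʳ g)) (act-e x))

·-∘ : {n : ℕ} (g h : W n) (f : F2V n) (x : Leaf n) → ((g ∘w h) · f) x ≡ (g · (h · f)) x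
·-∘ g h f x = cong f (trans (cong (λ t → act t x) (⁻¹-anti-homo-∙ g h)) (act-∘w (inv h) (inv g) x))

·-e : {n : ℕ} (f : F2V n) (x : Leaf n) → (e · f) x ≡ f x
·-e f x = cong f (trans (cong (λ t → act t x) ε⁻¹≈ε) (act-e x))

module ActionOnFixed {n : ℕ} {Y : W n → Set}
  (Y-∘ : {g h : W n} → Y g → Y h → Y (g ∘w h)) (Y-inv : {g : W n} → Y g → Y (inv g)) where

  ⁅⁆∈Frattini : {a b : W n} → Y a → Y b → Frattini Y ⁅ a , b ⁆
  ⁅⁆∈Frattini Ya Yb = Y-∘ (Y-∘ (Y-∘ Ya Yb) (Y-inv Ya)) (Y-inv Yb) ,
    λ M M-maximal → MaximalSubgroup.M-⁅⁆ Y-∘ Y-inv M-maximal Ya Yb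

  square∈Frattini : {a : W n} → Y a → Frattini Y (a ∘w a)
  square∈Frattini Ya = Y-∘ Ya Ya , λ M M-maximal → MaximalSubgroup.M-square Y-∘ Y-inv M-maximal Ya

  InFixSqComm : F2V n → Set
  InFixSqComm f = ((a b : W n) → Y a → Y b → InFix ⁅ a , b ⁆ f) × ((a : W n) → Y a → InFix (a ∘w a) f)

  Frattini-fixed⇒InFixSqComm : {f : F2V n} → InFixSet (Frattini Y) f → InFixSqComm f
  Frattini-fixed⇒InFixSqComm f∈Fix =
    (λ a b Ya Yb → f∈Fix _ (⁅⁆∈Frattini Ya Yb)) , (λ a Ya → f∈Fix _ (square∈Frattini Ya))

  ·-involutive : {f : F2V n} → InFixSqComm f → {a : W n} → Y a → (x : Leaf n) → (a · (a · f)) x ≡ f x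
  ·-involutive {f} (_ , fix²) {a} Ya x = trans (sym (·-∘ a a f x)) (fix² a Ya x)

  ·-comm : {f : F2V n} → InFixSqComm f → {a b : W n} → Y a → Y b →
           (x : Leaf n) → (a · (b · f)) x ≡ (b · (a · f)) x
  ·-comm {f} (fix⁅⁆ , _) {a} {b} Ya Yb x = begin
    (a · (b · f)) x                                 ≡⟨ sym (·-∘ a b f x) ⟩
    ((a ∘w b) · f) x                                ≡⟨ cong (λ t → (t · f) x) (∙-comm-up-to-⁅⁆ a b) ⟩
    (((b ∘w a) ∘w ⁅ inv a , inv b ⁆) · f) x         ≡⟨ ·-∘ (b ∘w a) _ f x ⟩
    (⁅ inv a , inv b ⁆ · f) (act (inv (b ∘w a)) x) ≡⟨ fix⁅⁆ (inv a) (inv b) (Y-inv Ya) (Y-inv Yb) _ ⟩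
    f (act (inv (b ∘w a)) x)                        ≡⟨ ·-∘ b a f x ⟩
    (b · (a · f)) x                                 ∎

  InFixSqComm-· : {f : F2V n} → InFixSqComm f → {g : W n} → Y g → InFixSqComm (g · f)
  InFixSqComm-· {f} (fix⁅⁆ , fix²) {g} Yg = fix⁅⁆′ , fix²′
    where
    conjugated : (x : W n) → InFix (conj (inv g) x) f → InFix x (g · f)
    conjugated x fixed y = begin
      (x · (g · f)) y                      ≡⟨ sym (·-∘ x g f y) ⟩
      ((x ∘w g) · f) y                     ≡⟨ cong (λ t → (t · f) y) (∙≡∙-conj x g) ⟩
      ((g ∘w conj (inv g) x) · f) y        ≡⟨ ·-∘ g _ f y ⟩
      (conj (inv g) x · f) (act (inv g) y) ≡⟨ fixed _ ⟩
      (g · f) y                            ∎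
    Yconj : {a : W n} → Y a → Y (conj (inv g) a)
    Yconj Ya = Y-∘ (Y-∘ (Y-inv Yg) Ya) (Y-inv (Y-inv Yg))
    fix⁅⁆′ : (a b : W n) → Y a → Y b → InFix ⁅ a , b ⁆ (g · f)
    fix⁅⁆′ a b Ya Yb = conjugated ⁅ a , b ⁆
      (subst (λ t → InFix t f) (sym (conj-⁅⁆ (inv g) a b)) (fix⁅⁆ _ _ (Yconj Ya) (Yconj Yb)))
    fix²′ : (a : W n) → Y a → InFix (a ∘w a) (g · f)
    fix²′ a Ya = conjugated (a ∘w a)
      (subst (λ t → InFix t f) (conj-homo-∙ (inv g) a a) (fix² _ (Yconj Ya)))

  ·-absorb : {f : F2V n} → InFixSqComm f → {a b : W n} → Y a → Y b →
             (x : Leaf n) → (a · (b · (a · f))) x ≡ (b · f) x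
  ·-absorb f-fixed {a} {b} Ya Yb x =
    trans (·-comm f-fixed Yb Ya (act (inv a) x)) (·-involutive (InFixSqComm-· f-fixed Yb) Ya x)

  ·-product-involutive : {f : F2V n} → InFixSqComm f → {a b : W n} → Y a → Y b →
                         (x : Leaf n) → (a · (b · (a · (b · f)))) x ≡ f x
  ·-product-involutive f-fixed Ya Yb x =
    trans (·-absorb (InFixSqComm-· f-fixed Yb) Ya Yb x) (·-involutive f-fixed Yb x)

_⊆ᵇ_ : {T : Set} → (T → Bool) → (T → Bool) → Set
S ⊆ᵇ S′ = ∀ x → S x ≡ true → S′ x ≡ true

module _ {T : Set} where

  count : (T → Bool) → List T → ℕ
  count S [] = 0
  count S (x ∷ xs) = (if S x then 1 else 0) + count S xs

  count-≤-length : (S : T → Bool) (xs : List T) → count S xs ≤ length xs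
  count-≤-length S [] = z≤n
  count-≤-length S (x ∷ xs) with S x
  ... | true = s≤s (count-≤-length S xs)
  ... | false = m≤n⇒m≤1+n (count-≤-length S xs)

  indicator-mono : {S S′ : T → Bool} → S ⊆ᵇ S′ → (x : T) →
                   (if S x then 1 else 0) ≤ (if S′ x then 1 else 0)
  indicator-mono {S} S⊆S′ x with S x in Sx
  ... | false = z≤n
  ... | true rewrite S⊆S′ x Sx = ≤-refl

  count-mono : {S S′ : T → Bool} → S ⊆ᵇ S′ → (xs : List T) → count S xs ≤ count S′ xs
  count-mono S⊆S′ [] = z≤n
  count-mono S⊆S′ (x ∷ xs) = +-mono-≤ (indicator-mono S⊆S′ x) (count-mono S⊆S′ xs)

  count-strict : {S S′ : T → Bool} → S ⊆ᵇ S′ → {x : T} {xs : List T} → x ∈ xs →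
                 S x ≡ false → S′ x ≡ true → count S xs < count S′ xs
  count-strict S⊆S′ {xs = _ ∷ xs} (here refl) Sx S′x rewrite Sx | S′x = s≤s (count-mono S⊆S′ xs)
  count-strict S⊆S′ {xs = y ∷ _} (there x∈xs) Sx S′x =
    +-mono-≤-< (indicator-mono S⊆S′ y) (count-strict S⊆S′ x∈xs Sx S′x)

module FiniteClosure {T : Set} (elements : List T) (complete : (x : T) → x ∈ elements)
  (step : (T → Bool) → T → Bool)
  (step-mono : {S S′ : T → Bool} → S ⊆ᵇ S′ → step S ⊆ᵇ step S′) where

  open Search elements complete

  Closed : (T → Bool) → Set
  Closed S = step S ⊆ᵇ S

  iterate : (T → Bool) → ℕ → T → Bool
  iterate seed zero = seed
  iterate seed (suc j) x = iterate seed j x ∨ step (iterate seed j) x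

  iterate-⊆-suc : (seed : T → Bool) (j : ℕ) → iterate seed j ⊆ᵇ iterate seed (suc j)
  iterate-⊆-suc seed j x = ∨-introˡ

  Closed-iterate-suc : (seed : T → Bool) (j : ℕ) → Closed (iterate seed j) → Closed (iterate seed (suc j))
  Closed-iterate-suc seed j closed x p = ∨-introˡ (closed x (step-mono shrink x p))
    where
    shrink : iterate seed (suc j) ⊆ᵇ iterate seed j
    shrink y q with ∨-elim (iterate seed j y) q
    ... | inj₁ r = r
    ... | inj₂ r = closed y r

  -- Until it becomes closed, each round adds an element, so the count bounds the rounds.
  closed-or-large : (seed : T → Bool) (j : ℕ) →
                    Closed (iterate seed j) ⊎ j ≤ count (iterate seed j) elements
  closed-or-large seed zero = inj₂ z≤n
  closed-or-large seed (suc j) with closed-or-large seed j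
  ... | inj₁ closed = inj₁ (Closed-iterate-suc seed j closed)
  ... | inj₂ large with ∃? (λ x → (step (iterate seed j) x ≟ true) ×-dec (iterate seed j x ≟ false))
  ...   | yes (x , new , old) = inj₂ (≤-trans (s≤s large)
          (count-strict (iterate-⊆-suc seed j) (complete x) old (∨-introʳ (iterate seed j x) new)))
  ...   | no ∄new = inj₁ (Closed-iterate-suc seed j closed)
    where
    closed : Closed (iterate seed j)
    closed x new with iterate seed j x in old
    ... | true = refl
    ... | false = ⊥-elim (∄new (x , new , old))

  closure : (T → Bool) → T → Bool
  closure seed = iterate seed (suc (length elements))

  closure-closed : (seed : T → Bool) → Closed (closure seed)
  closure-closed seed with closed-or-large seed (suc (length elements))
  ... | inj₁ closed = closed
  ... | inj₂ large = ⊥-elim (n≮n _ (≤-trans large (count-≤-length _ elements)))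

  seed⊆closure : (seed : T → Bool) → seed ⊆ᵇ closure seed
  seed⊆closure seed x = go (suc (length elements))
    where
    go : (j : ℕ) → seed x ≡ true → iterate seed j x ≡ true
    go zero p = p
    go (suc j) p = ∨-introˡ (go j p)

  closure-least : (seed : T → Bool) (Q : T → Set) → (∀ x → seed x ≡ true → Q x) →
    ((S : T → Bool) → (∀ x → S x ≡ true → Q x) → ∀ x → step S x ≡ true → Q x) →
    ∀ x → closure seed x ≡ true → Q x
  closure-least seed Q seed⊆Q step-preserves = go (suc (length elements))
    where
    go : (j : ℕ) → ∀ x → iterate seed j x ≡ true → Q x
    go zero = seed⊆Q
    go (suc j) x p with ∨-elim (iterate seed j x) p
    ... | inj₁ q = go j x q
    ... | inj₂ q = step-preserves (iterate seed j) (go j) x q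

-- The decomposition of v

module Decomposition {n : ℕ} {X : Subset n} (X-subgroup : IsSubgroup X) (α : W n) (v : F2V n)
  (condition₁ : (β : W n) → X β ≡ true
    → Σ (F2V n) λ u → InFixSet (Frattini (Gen X α)) u
        × ((a : Leaf n) → ((α · v) a xor ((α ∘w β) · v) a) ≡ (u a xor ((α ∘w β) · u) a)))
  (condition₂ : InFixSet (Frattini (Gen X α)) v) where

  open Subgroup X-subgroup

  Y : W n → Set
  Y = Gen X α

  Y-∘ : {g h : W n} → Y g → Y h → Y (g ∘w h)
  Y-∘ {g} {h} = mul g h

  Y-inv : {g : W n} → Y g → Y (inv g)
  Y-inv {g} = neg g

  open ActionOnFixed {Y = Y} Y-∘ Y-inv

  Yα : Y α
  Yα = gen

  YX : {β : W n} → X β ≡ true → Y β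
  YX {β} = base β

  v-fixed : InFixSqComm v
  v-fixed = Frattini-fixed⇒InFixSqComm condition₂

  αv+αβv≡u+αβu : {β : W n} → X β ≡ true → Σ (F2V n) λ u → InFixSqComm u ×
    ((x : Leaf n) → (α · v) x xor (α · (β · v)) x ≡ u x xor (α · (β · u)) x)
  αv+αβv≡u+αβu {β} Xβ with u , u-fixed , eq ← condition₁ β Xβ =
    u , Frattini-fixed⇒InFixSqComm u-fixed ,
    λ x → trans (cong ((α · v) x xor_) (sym (·-∘ α β v x))) (trans (eq x) (cong (u x xor_) (·-∘ α β u x)))

  d : F2V n
  d x = v x xor (α · v) x

  d-fixed-α : InFix α d
  d-fixed-α x = trans (cong ((α · v) x xor_) (·-involutive v-fixed Yα x)) (xor-comm _ (v x))

  d-fixed-X : {β : W n} → X β ≡ true → InFix β d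
  d-fixed-X {β} Xβ x with u , u-fixed , twisted ← αv+αβv≡u+αβu Xβ = begin
    (β · v) x xor (β · (α · v)) x ≡⟨ cong ((β · v) x xor_) (·-comm v-fixed Yβ Yα x) ⟩
    (β · v) x xor (α · (β · v)) x
      ≡⟨ xor-swap ((β · v) x) (v x) ((α · (β · v)) x) ((α · v) x) (trans βv+v (sym αβv+αv)) ⟩
    v x xor (α · v) x             ∎
    where
    Yβ : Y β
    Yβ = YX Xβ
    -- condition₁ transported by the involution αβ
    βv+v : (β · v) x xor v x ≡ (α · (β · u)) x xor u x
    βv+v = begin
      (β · v) x xor v x
        ≡⟨ sym (cong₂ _xor_ (·-absorb v-fixed Yα Yβ x)
                            (·-product-involutive v-fixed Yα Yβ x)) ⟩
      (α · (β · (α · v))) x xor (α · (β · (α · (β · v)))) x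
        ≡⟨ twisted (act (inv β) (act (inv α) x)) ⟩
      (α · (β · u)) x xor (α · (β · (α · (β · u)))) x
        ≡⟨ cong ((α · (β · u)) x xor_) (·-product-involutive u-fixed Yα Yβ x) ⟩
      (α · (β · u)) x xor u x ∎
    αβv+αv : (α · (β · v)) x xor (α · v) x ≡ (α · (β · u)) x xor u x
    αβv+αv = trans (xor-comm _ ((α · v) x)) (trans (twisted x) (xor-comm (u x) _))

  d-vanishes : {β : W n} → X β ≡ true → (y : Leaf n) →
               ((f : F2V n) → InFixSqComm f → f y ≡ (α · (β · f)) y) → d y ≡ false
  d-vanishes Xβ y αβ-fixes with u , u-fixed , twisted ← αv+αβv≡u+αβu Xβ = begin
    v y xor (α · v) y              ≡⟨ xor-comm (v y) _ ⟩
    (α · v) y xor v y              ≡⟨ cong ((α · v) y xor_) (αβ-fixes v v-fixed) ⟩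
    (α · v) y xor (α · (_ · v)) y  ≡⟨ twisted y ⟩
    u y xor (α · (_ · u)) y        ≡⟨ cong (u y xor_) (sym (αβ-fixes u u-fixed)) ⟩
    u y xor u y                    ≡⟨ xor-same (u y) ⟩
    false                          ∎

  open Search (all-W n) ∈-all-W using (∃?)
  open Search (all-Leaf n) ∈-all-Leaf using (choose; choose-cong; choose-sound)

  -- (y , p): the leaf y, reached along a path whose number of α-moves has parity p.
  Vertex : Set
  Vertex = Leaf n × Bool

  _≟ᵛ_ : (s t : Vertex) → Dec (s ≡ t)
  _≟ᵛ_ = Product.≡-dec (Vec.≡-dec _≟_) _≟_

  all-Vertex : List Vertex
  all-Vertex = cartesianProduct (all-Leaf n) bools

  ∈-all-Vertex : (s : Vertex) → s ∈ all-Vertex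
  ∈-all-Vertex (y , p) = ∈-cartesianProduct⁺ (∈-all-Leaf y) (∈-bools p)

  X-move : (Vertex → Bool) → Leaf n → Bool → Bool
  X-move S y p = does (∃? λ β → (X β ≟ true) ×-dec (S (act (inv β) y , p) ≟ true))

  step : (Vertex → Bool) → Vertex → Bool
  step S (y , p) = X-move S y p ∨ S (act (inv α) y , not p) ∨ S (act α y , not p)

  step-mono : {S S′ : Vertex → Bool} → S ⊆ᵇ S′ → step S ⊆ᵇ step S′
  step-mono {S} {S′} S⊆S′ (y , p) q with ∨-elim (X-move S y p) q
  ... | inj₁ q₁ with β , Xβ , Sβ ← does-sound (∃? _) q₁ = ∨-introˡ (dec-true (∃? _) (β , Xβ , S⊆S′ _ Sβ))
  ... | inj₂ q₂ with ∨-elim (S (act (inv α) y , not p)) q₂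
  ...   | inj₁ q₃ = ∨-introʳ (X-move S′ y p) (∨-introˡ (S⊆S′ _ q₃))
  ...   | inj₂ q₃ = ∨-introʳ (X-move S′ y p) (∨-introʳ (S′ (act (inv α) y , not p)) (S⊆S′ _ q₃))

  open FiniteClosure all-Vertex ∈-all-Vertex step step-mono

  origin : Leaf n → Vertex → Bool
  origin r s = does (s ≟ᵛ (r , false))

  Reach : Leaf n → Vertex → Bool
  Reach r = closure (origin r)

  twist : Bool → W n → F2V n → F2V n
  twist false β f = β · f
  twist true β f = α · (β · f)

  -- The invariant of reachability: a path from r to y with p moves by α acts on
  -- InFixSqComm vectors like α^p β for some β ∈ X.
  Sound : Leaf n → Vertex → Set
  Sound r (y , p) = Σ (W n) λ β → X β ≡ true × ((f : F2V n) → InFixSqComm f → f r ≡ twist p β f y)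

  sound-X : {r y : Leaf n} {β : W n} (p : Bool) → X β ≡ true →
            Sound r (act (inv β) y , p) → Sound r (y , p)
  sound-X {r} {y} {β} p Xβ (β′ , Xβ′ , h) = β ∘w β′ , ∋-∘ Xβ Xβ′ , λ f f-fixed → trans (h f f-fixed) (shift p f f-fixed)
    where
    shift : (p : Bool) (f : F2V n) → InFixSqComm f → twist p β′ f (act (inv β) y) ≡ twist p (β ∘w β′) f y
    shift false f _ = sym (·-∘ β β′ f y)
    shift true f f-fixed = trans (·-comm (InFixSqComm-· f-fixed (YX Xβ′)) (YX Xβ) Yα y)
                                 (sym (·-∘ β β′ f (act (inv α) y)))

  sound-α⁻¹ : {r y : Leaf n} (p : Bool) → Sound r (act (inv α) y , not p) → Sound r (y , p)
  sound-α⁻¹ {y = y} false (β , Xβ , h) = β , Xβ , λ f f-fixed →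
    trans (h f f-fixed) (·-involutive (InFixSqComm-· f-fixed (YX Xβ)) Yα y)
  sound-α⁻¹ true (β , Xβ , h) = β , Xβ , h

  sound-α : {r y : Leaf n} (p : Bool) → Sound r (act α y , not p) → Sound r (y , p)
  sound-α {y = y} false (β , Xβ , h) = β , Xβ , λ f f-fixed →
    trans (h f f-fixed) (cong (β · f) (act-inv-act α y))
  sound-α {y = y} true (β , Xβ , h) = β , Xβ , λ f f-fixed →
    trans (h f f-fixed) (trans (sym (·-involutive (InFixSqComm-· f-fixed (YX Xβ)) Yα (act α y)))
                               (cong (λ t → (β · f) (act (inv α) t)) (act-inv-act α y)))

  step-sound : (r : Leaf n) (S : Vertex → Bool) → (∀ s → S s ≡ true → Sound r s) →
               ∀ s → step S s ≡ true → Sound r s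
  step-sound r S S-sound (y , p) q with ∨-elim (X-move S y p) q
  ... | inj₁ q₁ with β , Xβ , Sβ ← does-sound (∃? _) q₁ = sound-X p Xβ (S-sound _ Sβ)
  ... | inj₂ q₂ with ∨-elim (S (act (inv α) y , not p)) q₂
  ...   | inj₁ q₃ = sound-α⁻¹ p (S-sound _ q₃)
  ...   | inj₂ q₃ = sound-α p (S-sound _ q₃)

  reach-sound : (r : Leaf n) (s : Vertex) → Reach r s ≡ true → Sound r s
  reach-sound r = closure-least (origin r) (Sound r) seed-sound (step-sound r)
    where
    seed-sound : ∀ s → origin r s ≡ true → Sound r s
    seed-sound s q with refl ← does-sound (s ≟ᵛ (r , false)) q = e , ∋-e , λ f _ → sym (·-e f r)

  reach-X : {r y : Leaf n} {p : Bool} {β : W n} → X β ≡ true →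
            Reach r (y , p) ≡ true → Reach r (act β y , p) ≡ true
  reach-X {r} {y} {p} {β} Xβ q = closure-closed (origin r) (act β y , p) (∨-introˡ (dec-true (∃? _)
    (β , Xβ , subst (λ t → Reach r (t , p) ≡ true) (sym (act-inv-act β y)) q)))

  reach-α : {r y : Leaf n} {p : Bool} → Reach r (y , p) ≡ true → Reach r (act α y , not p) ≡ true
  reach-α {r} {y} {p} q = closure-closed (origin r) (act α y , not p)
    (∨-introʳ (X-move (Reach r) (act α y) (not p)) (∨-introˡ
      (subst₂ (λ t b → Reach r (t , b) ≡ true) (sym (act-inv-act α y)) (sym (not-involutive p)) q)))

  reach-α⁻¹ : {r y : Leaf n} {p : Bool} → Reach r (y , p) ≡ true → Reach r (act (inv α) y , not p) ≡ true
  reach-α⁻¹ {r} {y} {p} q = closure-closed (origin r) (act (inv α) y , not p)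
    (∨-introʳ (X-move (Reach r) (act (inv α) y) (not p)) (∨-introʳ (Reach r (act (inv α) (act (inv α) y) , not (not p)))
      (subst₂ (λ t b → Reach r (t , b) ≡ true) (sym (act-act-inv α y)) (sym (not-involutive p)) q)))

  parities-conflict : {r y : Leaf n} → Sound r (y , false) → Sound r (y , true) → d y ≡ false
  parities-conflict {r} {y} (β₁ , Xβ₁ , h₁) (β₂ , Xβ₂ , h₂) = d-vanishes (∋-∘ Xβ₂ (∋-inv Xβ₁)) y αβ-fixes
    where
    αβ-fixes : (f : F2V n) → InFixSqComm f → f y ≡ (α · ((β₂ ∘w inv β₁) · f)) y
    αβ-fixes f f-fixed = begin
      f y                                ≡⟨ sym (·-e f y) ⟩
      (e · f) y                          ≡⟨ cong (λ t → (t · f) y) (sym (∘w-inverseʳ β₁)) ⟩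
      ((β₁ ∘w inv β₁) · f) y             ≡⟨ ·-∘ β₁ (inv β₁) f y ⟩
      (β₁ · (inv β₁ · f)) y              ≡⟨ sym (h₁ _ f′-fixed) ⟩
      (inv β₁ · f) r                     ≡⟨ h₂ _ f′-fixed ⟩
      (α · (β₂ · (inv β₁ · f))) y        ≡⟨ sym (·-∘ β₂ (inv β₁) f (act (inv α) y)) ⟩
      (α · ((β₂ ∘w inv β₁) · f)) y       ∎
      where
      f′-fixed : InFixSqComm (inv β₁ · f)
      f′-fixed = InFixSqComm-· f-fixed (Y-inv (YX Xβ₁))

  parity-unique : {r y : Leaf n} → d y ≡ true → Reach r (y , false) ≡ true → Reach r (y , true) ≡ true → ⊥
  parity-unique {r} {y} dy even odd =
    true≢false (trans (sym dy) (parities-conflict (reach-sound r (y , false) even) (reach-sound r (y , true) odd)))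

  connected : Leaf n → Leaf n → Bool
  connected x y = Reach x (y , false) ∨ Reach x (y , true)

  connected-intro : {x y : Leaf n} (p : Bool) → Reach x (y , p) ≡ true → connected x y ≡ true
  connected-intro false q = ∨-introˡ q
  connected-intro {x} {y} true q = ∨-introʳ (Reach x (y , false)) q

  connected-cong : {x y y′ : Leaf n} → (φ : Bool → Bool) →
    (∀ {p} → Reach x (y , p) ≡ true → Reach x (y′ , φ p) ≡ true) →
    connected x y ≡ true → connected x y′ ≡ true
  connected-cong {x} {y} φ move c with ∨-elim (Reach x (y , false)) c
  ... | inj₁ q = connected-intro (φ false) (move q)
  ... | inj₂ q = connected-intro (φ true) (move q)

  connected-α : (x y : Leaf n) → connected x (act (inv α) y) ≡ connected x y
  connected-α x y = ⇔→≡ (mk⇔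
    (connected-cong not (λ q → subst (λ t → Reach x (t , _) ≡ true) (act-act-inv α y) (reach-α q)))
    (connected-cong not reach-α⁻¹))

  connected-X : {β : W n} → X β ≡ true → (x y : Leaf n) → connected x (act (inv β) y) ≡ connected x y
  connected-X Xβ x y = ⇔→≡ (mk⇔
    (connected-cong (λ p → p) (λ q → subst (λ t → Reach x (t , _) ≡ true) (act-act-inv _ y) (reach-X Xβ q)))
    (connected-cong (λ p → p) (reach-X (∋-inv Xβ))))

  -- a base point of the ⟨X , α⟩-orbit of y that depends only on the orbit
  representative : Leaf n → Leaf n
  representative y = choose (λ x → connected x y) (replicate n false)

  representative-connected : (y : Leaf n) → connected (representative y) y ≡ true
  representative-connected y =
    choose-sound {P = λ x → connected x y}
      (connected-intro false (seed⊆closure (origin y) (y , false) (dec-true ((y , false) ≟ᵛ (y , false)) refl)))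
      (replicate n false)

  alternating : {r y : Leaf n} → d y ≡ true → connected r y ≡ true →
                Reach r (y , false) xor Reach r (act (inv α) y , false) ≡ true
  alternating {r} {y} dy c = xor≡true _ _
    (λ even → ¬-not (λ even′ → parity-unique (trans (d-fixed-α y) dy) even′ (reach-α⁻¹ even)))
    (λ ¬even → [ (λ even → ⊥-elim (true≢false (trans (sym even) ¬even))) , reach-α⁻¹ ]′
                 (∨-elim (Reach r (y , false)) c))

  A : F2V n
  A y = d y ∧ Reach (representative y) (y , false)

  A+αA≡d : (y : Leaf n) → A y xor (α · A) y ≡ d y
  A+αA≡d y = begin
    (d y ∧ Reach r (y , false)) xor (d (act (inv α) y) ∧ Reach (representative (act (inv α) y)) (act (inv α) y , false))
      ≡⟨ cong₂ (λ b r′ → (d y ∧ Reach r (y , false)) xor (b ∧ Reach r′ (act (inv α) y , false)))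
               (d-fixed-α y) (choose-cong (λ x → connected-α x y) (replicate n false)) ⟩
    (d y ∧ Reach r (y , false)) xor (d y ∧ Reach r (act (inv α) y , false))
      ≡⟨ sym (∧-distribˡ-xor (d y) _ _) ⟩
    d y ∧ (Reach r (y , false) xor Reach r (act (inv α) y , false))
      ≡⟨ ⇒→∧≡ˡ (d y) (λ dy → alternating dy (representative-connected y)) ⟩
    d y ∎
    where
    r : Leaf n
    r = representative y
  A-fixed-X : InFixSet (λ β → X β ≡ true) A
  A-fixed-X β Xβ y = cong₂ _∧_ (d-fixed-X Xβ y) (trans
    (cong (λ r → Reach r (act (inv β) y , false)) (choose-cong (λ x → connected-X Xβ x y) (replicate n false)))
    (⇔→≡ (mk⇔ (λ q → subst (λ t → Reach _ (t , false) ≡ true) (act-act-inv β y) (reach-X Xβ q))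
              (reach-X (∋-inv Xβ)))))

  w : F2V n
  w y = v y xor A y

  w-fixed-α : InFix α w
  w-fixed-α y = trans (xor-comm ((α · v) y) ((α · A) y))
    (sym (trans (xor-comm (v y) (A y)) (xor-swap (A y) ((α · A) y) (v y) ((α · v) y) (A+αA≡d y))))

  v≡w+A : (y : Leaf n) → v y ≡ w y xor A y
  v≡w+A y = sym (begin
    (v y xor A y) xor A y ≡⟨ xor-assoc (v y) (A y) (A y) ⟩
    v y xor (A y xor A y) ≡⟨ cong (v y xor_) (xor-same (A y)) ⟩
    v y xor false         ≡⟨ xor-identityʳ (v y) ⟩
    v y                   ∎)

  v∈Fixα+FixX : InFixSum α X v
  v∈Fixα+FixX = w , A , w-fixed-α , A-fixed-X , v≡w+A

proposition5p4 : (m : ℕ) → (X : Subset (suc m)) → IsSubgroup X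
    → (α : W (suc m)) → X α ≡ false
    → (v : F2V (suc m))
    → ((β : W (suc m)) → X β ≡ true
        → Σ (F2V (suc m)) λ u → InFixSet (Frattini (Gen X α)) u
            × ((a : Leaf (suc m))
                → ((α · v) a xor ((α ∘w β) · v) a) ≡ (u a xor ((α ∘w β) · u) a)))
    → InFixSet (Frattini (Gen X α)) v
    → InFixSum α X v
proposition5p4 m X X-subgroup α _ v condition₁ condition₂ =
  Decomposition.v∈Fixα+FixX X-subgroup α v condition₁ condition₂
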